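{- Let $(\Sigma,S,T)$ be an automata network, $s$ a global state, $g\in\Sigma$, $g_\top\in S(g)$ with $s(g)\neq g_\top$, and $\mathrm{valid}_s$ a predicate on objectives with the over-approximation property below. If $\pi$ is a trace from $s$ that is minimal with respect to $g_\top$ reachability from $s$, then its last step satisfies $\pi^{|\pi|}\subseteq\mathrm{tr}(\mathcal B)$.
   Context: An automata network $(\Sigma,S,T)$: finite set $\Sigma$ of automata; each $a\in\Sigma$ has a finite set $S(a)$ of local states (distinct across automata, $\mathbf{LS}=\bigcup_aS(a)$); global states are elements of $\prod_aS(a)$, $s(a)$ being the local state of $a$ in $s$; $\ell\subseteq s$ means every element of $\ell$ is a coordinate of $s$. $T(a)$ is a finite set of transitions $t=a_i\xrightarrow{\ell}a_j$ with $a_i\ne a_j\in S(a)$, $\ell\subseteq\mathbf{LS}\setminus S(a)$ with at most one local state per automaton; $\mathrm{orig}(t)=a_i$, $\mathrm{dest}(t)=a_j$, $\mathrm{enab}(t)=\ell$, $\mathrm{pre}(t)=\{a_i\}\cup\ell$, $\mathrm{post}(t)=\{a_j\}\cup\ell$. A step $\tau$ is a (possibly empty) set of transitions with at most one per automaton; $\mathrm{pre}(\tau)=\bigcup_{t\in\tau}\mathrm{pre}(t)$, $\mathrm{post}(\tau)=\bigcup_{t\in\tau}\mathrm{post}(t)\setminus\{\mathrm{orig}(t)\mid t\in\tau\}$; if $\mathrm{pre}(\tau)\subseteq s$, $s\cdot\tau$ replaces the local state of $a$ by $a_j$ for each $a_i\xrightarrow{\ell}a_j\in\tau$. A trace from $s$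 is a sequence of steps $\pi^1,\dots,\pi^{|\pi|}$ with $\mathrm{pre}(\pi^i)\subseteq s\cdot\pi^1\cdots\pi^{i-1}$. $\mathrm{post}(\pi)$ is the set of $a_j$ with $a_j\in\mathrm{post}(\pi^n)$ for some $n$ and $S(a)\cap\mathrm{post}(\pi^m)=\emptyset$ for all $m>n$. A trace $\pi$ from $s$ is minimal w.r.t. $g_\top$ reachability from $s$ if $g_\top\in\mathrm{post}(\pi)$ and there is no trace $\varpi\ne\pi$ from $s$ with $|\varpi|\le|\pi|$, $g_\top\in\mathrm{post}(\varpi)$ and a strictly increasing $\phi:\{1..|\varpi|\}\to\{1..|\pi|\}$ with $\varpi^i\subseteq\pi^{\phi(i)}$. An objective $a_i\leadsto a_j$ is a pair of local states of the same automaton. $\mathrm{local\text{ - }paths}(a_i\leadsto a_i)=\{\varepsilon\}$; for $i\ne j$ it is the set of nonempty sequences $\eta$ of transitions of $T(a)$ with $\mathrm{orig}(\eta^1)=a_i$, $\mathrm{dest}(\eta^{|\eta|})=a_j$, $\mathrm{dest}(\eta^n)=\mathrm{orig}(\eta^{n+1})$, and $\mathrm{dest}(\eta^n)\ne\mathrm{orig}(\eta^m)$ for $n>m$. $\mathrm{valid}_s$ is a predicate on objectives such that $\mathrm{valid}_s(a_i\leadsto a_j)$ holds whenever some trace $\pi$ from $s$ has indices $m\le n$ with $a_i\in\mathrm{pre}(\pi^m)$, $a_j\in\mathrm{post}(\pi^n)$. Write $a_0:=s(a)$ for each automaton $a$. $\mathrm{rcsol}_s(P)=\{\eta\in\mathrm{local\text{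 - }paths}(P)\mid\forall n,\forall b_k\in\mathrm{enab}(\eta^n),\ \mathrm{valid}_s(b_0\leadsto b_k)\}$, and $\mathrm{tr}(\mathrm{rcsol}_s(P))$ is the set of transitions occurring in its paths. $\mathcal B$ is the smallest set of objectives with: (1) $g_0\leadsto g_\top\in\mathcal B$; (2) if $b_j\xrightarrow{\ell}b_k\in\mathrm{tr}(\mathcal B)$ then $a_0\leadsto a_i\in\mathcal B$ for all $a_i\in\ell$; (3) if $b_j\xrightarrow{\ell}b_k\in\mathrm{tr}(\mathcal B)$ and $b_\star\leadsto b_i\in\mathcal B$ for some $b_\star$, then $b_k\leadsto b_i\in\mathcal B$; where $\mathrm{tr}(\mathcal B)=\bigcup_{P\in\mathcal B}\mathrm{tr}(\mathrm{rcsol}_s(P))$. -}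

module Defs where

open import Data.Nat using (ℕ; zero; suc; _≤_; _<_)
open import Data.Fin using (Fin; toℕ)
open import Data.Maybe using (Maybe; just; nothing; maybe)
open import Data.Product using (Σ; Σ-syntax; _×_; _,_; proj₁; proj₂)
open import Data.Sum using (_⊎_)
open import Data.List using (List; []; _∷_; length; lookup; _++_; [_])
open import Data.List.Membership.Propositional using (_∈_)
open import Data.List.Relation.Binary.Pointwise using (Pointwise)
open import Relation.Binary.PropositionalEquality using (_≡_; _≢_)
open import Relation.Nullary using (¬_)

-- Local states of automaton a: Fin (k a)
-- (tagged by the automaton, so distinct across automata).
-- Transitions of automaton a: T(a) indexed by Fin (m a), each with
-- orig, dest and an enabling set given as a partial map
-- (at most one local state per automaton, none of automaton a).

record Network : Set where
  field
    n    : ℕ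
    k    : Fin n → ℕ
    m    : Fin n → ℕ
    orig : ∀ {a} → Fin (m a) → Fin (k a)
    dest : ∀ {a} → Fin (m a) → Fin (k a)
    enab : ∀ {a} → Fin (m a) → (b : Fin n) → Maybe (Fin (k b))
    orig≢dest : ∀ a (t : Fin (m a)) → orig t ≢ dest t
    enab-self : ∀ a (t : Fin (m a)) → enab t a ≡ nothing
    -- T(a) is a *set*: distinct indices denote distinct transitions
    distinct  : ∀ a (t t′ : Fin (m a)) → orig t ≡ orig t′ → dest t ≡ dest t′ →
                (∀ b → enab t b ≡ enab t′ b) → t ≡ t′

module _ (N : Network) where
  open Network N

  Aut : Set
  Aut = Fin n

  LS : Set
  LS = Σ (Fin n) (λ a → Fin (k a))

  State : Set
  State = (a : Fin n) → Fin (k a)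

  InState : State → LS → Set
  InState s x = s (proj₁ x) ≡ proj₂ x

  Step : Set
  Step = (a : Fin n) → Maybe (Fin (m a))

  _⊆ₛ_ : Step → Step → Set
  τ ⊆ₛ τ′ = ∀ a t → τ a ≡ just t → τ′ a ≡ just t

  PreStep : Step → LS → Set
  PreStep τ (b , j) = Σ[ a ∈ Fin n ] Σ[ t ∈ Fin (m a) ]
    (τ a ≡ just t × (((a , orig t) ≡ (b , j)) ⊎ (enab t b ≡ just j)))

  PostStep : Step → LS → Set
  PostStep τ (b , j) =
    (Σ[ a ∈ Fin n ] Σ[ t ∈ Fin (m a) ]
      (τ a ≡ just t × (((a , dest t) ≡ (b , j)) ⊎ (enab t b ≡ just j))))
    × ¬ (Σ[ a ∈ Fin n ] Σ[ t ∈ Fin (m a) ] (τ a ≡ just t × (a , orig t) ≡ (b , j)))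

  Enabled : State → Step → Set
  Enabled s τ = ∀ x → PreStep τ x → InState s x

  apply : State → Step → State
  apply s τ a = maybe (dest {a}) (s a) (τ a)

  data IsTrace : State → List Step → Set where
    []  : ∀ {s} → IsTrace s []
    _∷_ : ∀ {s τ π} → Enabled s τ → IsTrace (apply s τ) π → IsTrace s (τ ∷ π)

  PostTrace : List Step → LS → Set
  PostTrace π x = Σ[ p ∈ Fin (length π) ]
    (PostStep (lookup π p) x ×
     (∀ (q : Fin (length π)) → toℕ p < toℕ q →
        ∀ j → ¬ PostStep (lookup π q) (proj₁ x , j)))

  TraceEq : List Step → List Step → Set
  TraceEq = Pointwise (λ τ τ′ → ∀ a → τ a ≡ τ′ a)

  StrictInc : ∀ {p q} → (Fin p → Fin q) → Set
  StrictInc φ = ∀ i j → toℕ i < toℕ j → toℕ (φ i) < toℕ (φ j)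

  -- π (assumed a trace from s) is minimal w.r.t. g⊤ reachability from s
  Minimal : State → (g : Fin n) → Fin (k g) → List Step → Set
  Minimal s g g⊤ π =
    PostTrace π (g , g⊤) ×
    ¬ (Σ[ ϖ ∈ List Step ]
         (¬ TraceEq ϖ π × IsTrace s ϖ × length ϖ ≤ length π ×
          PostTrace ϖ (g , g⊤) ×
          Σ[ φ ∈ (Fin (length ϖ) → Fin (length π)) ]
            (StrictInc φ × (∀ i → lookup ϖ i ⊆ₛ lookup π (φ i)))))

  ObjPred : Set₁
  ObjPred = (a : Fin n) → Fin (k a) → Fin (k a) → Set

  OverApprox : State → ObjPred → Set
  OverApprox s valid = ∀ a i j →
    (Σ[ π ∈ List Step ] (IsTrace s π ×
       Σ[ p ∈ Fin (length π) ] Σ[ q ∈ Fin (length π) ]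
         (toℕ p ≤ toℕ q × PreStep (lookup π p) (a , i) ×
          PostStep (lookup π q) (a , j)))) →
    valid a i j

  IsPath : (a : Fin n) → Fin (k a) → Fin (k a) → List (Fin (m a)) → Set
  IsPath a i j η =
    (Σ[ t ∈ Fin (m a) ] Σ[ η′ ∈ List (Fin (m a)) ] (η ≡ t ∷ η′ × orig t ≡ i)) ×
    (∀ ρ u → η ≡ ρ ++ [ u ] → dest u ≡ j) ×
    (∀ (p q : Fin (length η)) → toℕ q ≡ suc (toℕ p) →
       dest (lookup η p) ≡ orig (lookup η q)) ×
    (∀ (p q : Fin (length η)) → toℕ q < toℕ p →
       dest (lookup η p) ≢ orig (lookup η q))

  LocalPath : (a : Fin n) → Fin (k a) → Fin (k a) → List (Fin (m a)) → Set
  LocalPath a i j η = (i ≡ j × η ≡ []) ⊎ (i ≢ j × IsPath a i j η)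

  RCSol : State → ObjPred → (a : Fin n) → Fin (k a) → Fin (k a) →
          List (Fin (m a)) → Set
  RCSol s valid a i j η =
    LocalPath a i j η ×
    (∀ (p : Fin (length η)) b l → enab (lookup η p) b ≡ just l → valid b (s b) l)

  -- the set 𝓑 (inductive = smallest set closed under (1)-(3)),
  -- with tr(𝓑) inlined: t ∈ tr(rcsol_s(b_x ⇝ b_y)) for some b_x ⇝ b_y ∈ 𝓑
  data InB (s : State) (g : Fin n) (g⊤ : Fin (k g)) (valid : ObjPred) :
           (a : Fin n) → Fin (k a) → Fin (k a) → Set where
    rule1 : InB s g g⊤ valid g (s g) g⊤
    rule2 : ∀ b (t : Fin (m b)) x y (η : List (Fin (m b))) →
            InB s g g⊤ valid b x y → RCSol s valid b x y η → t ∈ η →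
            ∀ a i → enab t a ≡ just i → InB s g g⊤ valid a (s a) i
    rule3 : ∀ b (t : Fin (m b)) x y (η : List (Fin (m b))) →
            InB s g g⊤ valid b x y → RCSol s valid b x y η → t ∈ η →
            ∀ b⋆ i → InB s g g⊤ valid b b⋆ i → InB s g g⊤ valid b (dest t) i

  InTrB : State → (g : Fin n) → Fin (k g) → ObjPred → (a : Fin n) → Fin (m a) → Set
  InTrB s g g⊤ valid a t =
    Σ[ x ∈ Fin (k a) ] Σ[ y ∈ Fin (k a) ] Σ[ η ∈ List (Fin (m a)) ]
      (InB s g g⊤ valid a x y × RCSol s valid a x y η × t ∈ η)

  StepInTrB : State → (g : Fin n) → Fin (k g) → ObjPred → Step → Set
  StepInTrB s g g⊤ valid τ = ∀ a t → τ a ≡ just t → InTrB s g g⊤ valid a t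

-- Minimality rules out every proper prefix and every proper sub-step of the last step τ as a way of
-- reaching g⊤. So τ fires exactly one transition, of g, into g⊤, and g never visited g⊤ before.
-- The transitions of g along the trace form a walk from g₀ to g⊤ whose only edge into g⊤ is the one
-- in τ; erasing its loops gives a local path of g₀ ⇝ g⊤ that still contains it. Each transition on
-- this path fired in the trace, so each of its enabling states b_l is reached from b₀ by a trace and
-- valid(b₀ ⇝ b_l) holds by over-approximation. Hence the path is in rcsol(g₀ ⇝ g⊤), and g₀ ⇝ g⊤ ∈ 𝓑.
module Submission where

open import Defs
open import Data.Nat using (suc; _≤_; _<_; z≤n; s≤s)
open import Data.Nat.Properties using (<⇒≱; suc-injective)
open import Data.Fin using (Fin; zero; suc; toℕ; _≟_)
open import Data.Maybe using (just; nothing)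
open import Data.Maybe.Properties using (just-injective)
open import Data.Product using (Σ-syntax; ∃-syntax; _×_; _,_; proj₁)
open import Data.Product.Properties using (Σ-≡,≡←≡)
open import Data.Sum using (_⊎_; inj₁; inj₂)
open import Data.Empty using (⊥-elim)
open import Function using (_∘_; case_of_)
open import Data.List using (List; []; _∷_; _++_; [_]; length; lookup; foldl)
open import Data.List.Properties using (∷-injectiveʳ; ++-assoc; ++-conicalʳ; foldl-∷ʳ)
open import Data.List.Membership.Propositional using (_∈_)
open import Data.List.Membership.Propositional.Properties using (∈-∃++; ∈-++⁻; ∈-lookup)
open import Data.List.Relation.Unary.Any using (Any; here; there; any?)
import Data.List.Relation.Unary.Any as Any
open import Data.List.Relation.Binary.Subset.Propositional using (_⊆_)
open import Data.List.Relation.Binary.Subset.Propositional.Properties using (∷⁺ʳ)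
open import Data.List.Relation.Binary.Pointwise using (Pointwise; []; _∷_; ++-cancelˡ)
open import Data.List.Relation.Binary.Sublist.Heterogeneous using (Sublist; []; _∷_; _∷ʳ_)
open import Data.List.Relation.Binary.Sublist.Heterogeneous.Properties using (length-mono-≤; ++⁺; ++ʳ)
import Data.List.Relation.Binary.Sublist.Heterogeneous.Properties as Sublist
open import Relation.Binary.Definitions using (DecidableEquality)
open import Relation.Binary.PropositionalEquality
  using (_≡_; _≢_; refl; sym; trans; cong; cong-app; subst; subst₂; module ≡-Reasoning)
open import Relation.Nullary using (¬_; yes; no)

module _ {A : Set} where

  injectˡ : (xs ys : List A) → Fin (length xs) → Fin (length (xs ++ ys))
  injectˡ (_ ∷ _)  ys zero    = zero
  injectˡ (_ ∷ xs) ys (suc i) = suc (injectˡ xs ys i)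

  toℕ-injectˡ : ∀ (xs ys : List A) i → toℕ (injectˡ xs ys i) ≡ toℕ i
  toℕ-injectˡ (_ ∷ _)  ys zero    = refl
  toℕ-injectˡ (_ ∷ xs) ys (suc i) = cong suc (toℕ-injectˡ xs ys i)

  lookup-injectˡ : ∀ (xs ys : List A) i → lookup (xs ++ ys) (injectˡ xs ys i) ≡ lookup xs i
  lookup-injectˡ (_ ∷ _)  ys zero    = refl
  lookup-injectˡ (_ ∷ xs) ys (suc i) = lookup-injectˡ xs ys i

  lastIndex : ∀ (xs : List A) x → Fin (length (xs ++ [ x ]))
  lastIndex []       x = zero
  lastIndex (_ ∷ xs) x = suc (lastIndex xs x)

  toℕ-lastIndex : ∀ (xs : List A) x → toℕ (lastIndex xs x) ≡ length xs
  toℕ-lastIndex []       x = refl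
  toℕ-lastIndex (_ ∷ xs) x = cong suc (toℕ-lastIndex xs x)

  lookup-lastIndex : ∀ (xs : List A) x → lookup (xs ++ [ x ]) (lastIndex xs x) ≡ x
  lookup-lastIndex []       x = refl
  lookup-lastIndex (_ ∷ xs) x = lookup-lastIndex xs x

  toℕ≤length : ∀ (xs : List A) x (i : Fin (length (xs ++ [ x ]))) → toℕ i ≤ length xs
  toℕ≤length []       x zero    = z≤n
  toℕ≤length (_ ∷ xs) x zero    = z≤n
  toℕ≤length (_ ∷ xs) x (suc i) = s≤s (toℕ≤length xs x i)

  ++[-]-index : ∀ (xs : List A) x (i : Fin (length (xs ++ [ x ]))) →
                (∃[ j ] i ≡ injectˡ xs [ x ] j) ⊎ i ≡ lastIndex xs x
  ++[-]-index []       x zero    = inj₂ refl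
  ++[-]-index (_ ∷ xs) x zero    = inj₁ (zero , refl)
  ++[-]-index (_ ∷ xs) x (suc i) with ++[-]-index xs x i
  ... | inj₁ (j , i≡j) = inj₁ (suc j , cong suc i≡j)
  ... | inj₂ i≡last   = inj₂ (cong suc i≡last)

  Pointwise-++-identityʳ-unique : ∀ {R : A → A → Set} xs {ys} → Pointwise R xs (xs ++ ys) → ys ≡ []
  Pointwise-++-identityʳ-unique []       []       = refl
  Pointwise-++-identityʳ-unique (_ ∷ xs) (_ ∷ rs) = Pointwise-++-identityʳ-unique xs rs

module _ {A B : Set} where

  StrictlyMonotone : ∀ {p q} → (Fin p → Fin q) → Set
  StrictlyMonotone φ = ∀ i j → toℕ i < toℕ j → toℕ (φ i) < toℕ (φ j)

  Embedding : (A → B → Set) → List A → List B → Set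
  Embedding R xs ys = Σ[ φ ∈ (Fin (length xs) → Fin (length ys)) ]
    (StrictlyMonotone φ × ∀ i → R (lookup xs i) (lookup ys (φ i)))

  module _ {R : A → B → Set} where

    Embedding-∷ʳ : ∀ {xs y ys} → Embedding R xs ys → Embedding R xs (y ∷ ys)
    Embedding-∷ʳ (φ , mono , rel) = (λ i → suc (φ i)) , (λ i j i<j → s≤s (mono i j i<j)) , rel

    Embedding-∷ : ∀ {x xs y ys} → R x y → Embedding R xs ys → Embedding R (x ∷ xs) (y ∷ ys)
    Embedding-∷ {x} {xs} {y} {ys} r (φ , mono , rel) = φ′ , mono′ , rel′
      where
      φ′ : Fin (length (x ∷ xs)) → Fin (length (y ∷ ys))
      φ′ zero    = zero
      φ′ (suc i) = suc (φ i)
      mono′ : StrictlyMonotone φ′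
      mono′ zero    (suc j) _         = s≤s z≤n
      mono′ (suc i) (suc j) (s≤s i<j) = s≤s (mono i j i<j)
      rel′ : ∀ i → R (lookup (x ∷ xs) i) (lookup (y ∷ ys) (φ′ i))
      rel′ zero    = r
      rel′ (suc i) = rel i

    Sublist⇒Embedding : ∀ {xs ys} → Sublist R xs ys → Embedding R xs ys
    Sublist⇒Embedding []         = (λ ()) , (λ ()) , (λ ())
    Sublist⇒Embedding {xs} (_ ∷ʳ sub) = Embedding-∷ʳ {xs = xs} (Sublist⇒Embedding sub)
    Sublist⇒Embedding (r ∷ sub)       = Embedding-∷ r (Sublist⇒Embedding sub)

module Walks {V E : Set} (src tgt : E → V) (_≟_ : DecidableEquality V) where

  data Walk : V → V → List E → Set where
    nil  : ∀ {x} → Walk x x []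
    cons : ∀ {x y e es} → src e ≡ x → Walk (tgt e) y es → Walk x y (e ∷ es)

  data SimplePath : V → V → List E → Set where
    nil  : ∀ {x} → SimplePath x x []
    cons : ∀ {x y e es} → src e ≡ x → SimplePath (tgt e) y es →
           x ≢ y → (∀ {e′} → e′ ∈ es → src e′ ≢ x) → SimplePath x y (e ∷ es)

  SimplePath⇒Walk : ∀ {x y es} → SimplePath x y es → Walk x y es
  SimplePath⇒Walk nil                = nil
  SimplePath⇒Walk (cons src≡x p _ _) = cons src≡x (SimplePath⇒Walk p)

  Walk-enters : ∀ {x y es} → Walk x y es → x ≢ y → ∃[ e ] (e ∈ es × tgt e ≡ y)
  Walk-enters nil x≢x = ⊥-elim (x≢x refl)
  Walk-enters {y = y} (cons {e = e} _ w) _ with tgt e ≟ y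
  ... | yes tgt≡y = e , here refl , tgt≡y
  ... | no tgt≢y with e′ , e′∈es , tgt≡y ← Walk-enters w tgt≢y = e′ , there e′∈es , tgt≡y

  Walk-ends : ∀ {x y es} → Walk x y es → ∀ fs f → es ≡ fs ++ [ f ] → tgt f ≡ y
  Walk-ends (cons _ nil)        []       f refl = refl
  Walk-ends (cons _ w)          (_ ∷ fs) f eq   = Walk-ends w fs f (∷-injectiveʳ eq)
  Walk-ends (cons _ (cons _ _)) []       f ()

  Walk-chained : ∀ {x y es} → Walk x y es → ∀ p q → toℕ q ≡ suc (toℕ p) →
                 tgt (lookup es p) ≡ src (lookup es q)
  Walk-chained (cons _ (cons src≡ _)) zero    (suc zero) refl = sym src≡
  Walk-chained (cons _ w)             (suc p) (suc q)    eq   = Walk-chained w p q (suc-injective eq)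

  Walk-tgt-visited : ∀ {x y es} → Walk x y es → ∀ p →
                     tgt (lookup es p) ≡ y ⊎ ∃[ e ] (e ∈ es × src e ≡ tgt (lookup es p))
  Walk-tgt-visited (cons _ nil)                   zero    = inj₁ refl
  Walk-tgt-visited (cons _ (cons {e = e} src≡ _)) zero    = inj₂ (e , there (here refl) , src≡)
  Walk-tgt-visited (cons _ w)                     (suc p) with Walk-tgt-visited w p
  ... | inj₁ tgt≡y             = inj₁ tgt≡y
  ... | inj₂ (e , e∈es , src≡) = inj₂ (e , there e∈es , src≡)

  SimplePath-fresh : ∀ {x y es} → SimplePath x y es → ∀ p q → toℕ q < toℕ p →
                     tgt (lookup es p) ≢ src (lookup es q)
  SimplePath-fresh (cons src≡x p x≢y fresh) (suc i) zero _ tgt≡src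
    with Walk-tgt-visited (SimplePath⇒Walk p) i
  ... | inj₁ tgt≡y             = x≢y (trans (sym (trans tgt≡src src≡x)) tgt≡y)
  ... | inj₂ (e , e∈es , src≡) = fresh e∈es (trans src≡ (trans tgt≡src src≡x))
  SimplePath-fresh (cons _ p _ _) (suc i) (suc j) (s≤s j<i) = SimplePath-fresh p i j j<i

  SimplePath-from : ∀ {x y z es} → Any (λ e → src e ≡ x) es → SimplePath z y es →
                    ∃[ es′ ] (SimplePath x y es′ × es′ ⊆ es)
  SimplePath-from (here src≡x) p@(cons src≡z _ _ _) =
    _ , subst (λ v → SimplePath v _ _) (trans (sym src≡z) src≡x) p , λ e∈ → e∈
  SimplePath-from (there visits) (cons _ p _ _) with es′ , p′ , es′⊆es ← SimplePath-from visits p =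
    es′ , p′ , λ e∈ → there (es′⊆es e∈)

  erase-loops : ∀ {x y es} → Walk x y es → ∃[ es′ ] (SimplePath x y es′ × es′ ⊆ es)
  erase-loops nil = [] , nil , λ ()
  erase-loops {x} {y} (cons {e = e} src≡x w) with erase-loops w
  ... | es′ , p , es′⊆es with x ≟ y
  ...   | yes refl = [] , nil , λ ()
  ...   | no x≢y with any? (λ e′ → src e′ ≟ x) es′
  ...     | yes visits with es″ , p″ , es″⊆es′ ← SimplePath-from visits p =
    es″ , p″ , λ e∈ → there (es′⊆es (es″⊆es′ e∈))
  ...     | no ¬visits =
    e ∷ es′ , cons src≡x p x≢y (λ e′∈ src≡x′ → ¬visits (Any.map (λ { refl → src≡x′ }) e′∈)) ,
    ∷⁺ʳ e es′⊆es

nothing≢just : ∀ {A : Set} {x : A} → nothing ≢ just x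
nothing≢just ()

module _ (N : Network) where
  open Network N

  module Local (a : Aut N) = Walks (orig {a}) (dest {a}) _≟_

  run : State N → List (Step N) → State N
  run = foldl (apply N)

  apply-nothing : ∀ s (σ : Step N) {a} → σ a ≡ nothing → apply N s σ a ≡ s a
  apply-nothing s σ σa≡nothing rewrite σa≡nothing = refl

  apply-just : ∀ s (σ : Step N) {a t} → σ a ≡ just t → apply N s σ a ≡ dest t
  apply-just s σ σa≡t rewrite σa≡t = refl

  Enabled⇒orig : ∀ {s σ a t} → Enabled N s σ → σ a ≡ just t → s a ≡ orig t
  Enabled⇒orig {a = a} {t} en σa≡t = en (a , orig t) (a , t , σa≡t , inj₁ refl)

  Enabled⇒enab : ∀ {s σ a t b l} → Enabled N s σ → σ a ≡ just t → enab t b ≡ just l → s b ≡ l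
  Enabled⇒enab {a = a} {t} {b} {l} en σa≡t enab≡l = en (b , l) (a , t , σa≡t , inj₂ enab≡l)

  ⊆ₛ-refl : ∀ {σ} → _⊆ₛ_ N σ σ
  ⊆ₛ-refl _ _ σa≡t = σa≡t

  Enabled-⊆ₛ : ∀ {s σ σ′} → Enabled N s σ → _⊆ₛ_ N σ′ σ → Enabled N s σ′
  Enabled-⊆ₛ en σ′⊆σ x (a , t , σ′a≡t , pre) = en x (a , t , σ′⊆σ a t σ′a≡t , pre)

  IsTrace-++⁻ : ∀ {s} xs {ys} → IsTrace N s (xs ++ ys) → IsTrace N s xs × IsTrace N (run s xs) ys
  IsTrace-++⁻ []       tr         = [] , tr
  IsTrace-++⁻ (_ ∷ xs) (en ∷ tr) with trxs , trys ← IsTrace-++⁻ xs tr = en ∷ trxs , trys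

  IsTrace-++⁺ : ∀ {s xs ys} → IsTrace N s xs → IsTrace N (run s xs) ys → IsTrace N s (xs ++ ys)
  IsTrace-++⁺ []         trys = trys
  IsTrace-++⁺ (en ∷ trxs) trys = en ∷ IsTrace-++⁺ trxs trys

  PostStep-dest : ∀ {σ : Step N} {a t} → σ a ≡ just t → PostStep N σ (a , dest t)
  PostStep-dest {σ} {a} {t} σa≡t = (a , t , σa≡t , inj₁ refl) , not-an-origin
    where
    not-an-origin : ¬ (Σ[ b ∈ Aut N ] Σ[ u ∈ Fin (m b) ] (σ b ≡ just u × (b , orig u) ≡ (a , dest t)))
    not-an-origin (b , u , σb≡u , eq) with refl , orig≡dest ← Σ-≡,≡←≡ eq
      with refl ← just-injective (trans (sym σa≡t) σb≡u) = orig≢dest a t orig≡dest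

  PostTrace-++[-]⁺ : ∀ xs x {y} → PostStep N x y → PostTrace N (xs ++ [ x ]) y
  PostTrace-++[-]⁺ xs x {y} post =
    lastIndex xs x , subst (λ σ → PostStep N σ y) (sym (lookup-lastIndex xs x)) post ,
    λ q last<q _ _ → <⇒≱ (subst (_< toℕ q) (toℕ-lastIndex xs x) last<q) (toℕ≤length xs x q)

  PostTrace-++[-]⁻ : ∀ xs x {y} → PostTrace N (xs ++ [ x ]) y → PostTrace N xs y ⊎ PostStep N x y
  PostTrace-++[-]⁻ xs x {y} (p , post , final) with ++[-]-index xs x p
  ... | inj₂ refl = inj₂ (subst (λ σ → PostStep N σ y) (lookup-lastIndex xs x) post)
  ... | inj₁ (i , refl) =
    inj₁ (i , subst (λ σ → PostStep N σ y) (lookup-injectˡ xs [ x ] i) post ,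
          λ q i<q j postq → final (injectˡ xs [ x ] q)
            (subst₂ _<_ (sym (toℕ-injectˡ xs [ x ] i)) (sym (toℕ-injectˡ xs [ x ] q)) i<q) j
            (subst (λ σ → PostStep N σ (proj₁ y , j)) (sym (lookup-injectˡ xs [ x ] q)) postq))

  _without_ : Step N → Aut N → Step N
  (σ without a) b with a ≟ b
  ... | yes _ = nothing
  ... | no  _ = σ b

  without-self : ∀ σ a → (σ without a) a ≡ nothing
  without-self σ a with a ≟ a
  ... | yes _   = refl
  ... | no  a≢a = ⊥-elim (a≢a refl)

  without-other : ∀ σ {a b} → a ≢ b → (σ without a) b ≡ σ b
  without-other σ {a} {b} a≢b with a ≟ b
  ... | yes a≡b = ⊥-elim (a≢b a≡b)
  ... | no  _   = refl

  without-⊆ₛ : ∀ σ a → _⊆ₛ_ N (σ without a) σ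
  without-⊆ₛ σ a b t with a ≟ b
  ... | yes _ = λ ()
  ... | no  _ = λ σb≡t → σb≡t

  -- The premise of OverApprox: OverApprox N s valid unfolds to ∀ a i j → Realised s a i j → valid a i j.
  Realised : State N → (a : Aut N) → Fin (k a) → Fin (k a) → Set
  Realised s a i j = Σ[ π ∈ List (Step N) ] (IsTrace N s π ×
    Σ[ p ∈ Fin (length π) ] Σ[ q ∈ Fin (length π) ]
      (toℕ p ≤ toℕ q × PreStep N (lookup π p) (a , i) × PostStep N (lookup π q) (a , j)))

  -- If α moves b, its first move of b starts from b₀. Otherwise b is still at b₀ when σ fires,
  -- and σ without b's own transition keeps b_l = b₀ in its pre-set and puts b_l in its post-set.
  enabling-realised : ∀ {s} α {σ a t b l} → IsTrace N s α → Enabled N (run s α) σ →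
                      σ a ≡ just t → enab t b ≡ just l → Realised s b (s b) l
  enabling-realised {s} [] {σ} {a} {t} {b} {l} [] en σa≡t enab≡l =
    σ without b ∷ [] , Enabled-⊆ₛ en (without-⊆ₛ σ b) ∷ [] , zero , zero , z≤n , pre , post
    where
    b≢a : b ≢ a
    b≢a refl = nothing≢just (trans (sym (enab-self a t)) enab≡l)
    σ∖b-moves-a : (σ without b) a ≡ just t
    σ∖b-moves-a = trans (without-other σ b≢a) σa≡t
    pre : PreStep N (σ without b) (b , s b)
    pre = a , t , σ∖b-moves-a , inj₂ (trans enab≡l (cong just (sym (Enabled⇒enab en σa≡t enab≡l))))
    post : PostStep N (σ without b) (b , l)
    post = (a , t , σ∖b-moves-a , inj₂ enab≡l) , λ where
      (b′ , u , σ∖b-moves-b′ , orig≡) → case Σ-≡,≡←≡ orig≡ of λ where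
        (refl , _) → nothing≢just (trans (sym (without-self σ b)) σ∖b-moves-b′)
  enabling-realised {s} (σ₀ ∷ α) {b = b} (en₀ ∷ tr) en σa≡t enab≡l
    with enabling-realised α tr en σa≡t enab≡l | σ₀ b in σ₀b
  ... | ϖ , trϖ , p , q , p≤q , pre , post | nothing =
    σ₀ ∷ ϖ , en₀ ∷ trϖ , suc p , suc q , s≤s p≤q ,
    subst (λ v → PreStep N (lookup ϖ p) (b , v)) (apply-nothing s σ₀ σ₀b) pre , post
  ... | ϖ , trϖ , p , q , p≤q , pre , post | just u =
    σ₀ ∷ ϖ , en₀ ∷ trϖ , zero , suc q , z≤n ,
    (b , u , σ₀b , inj₁ (cong (b ,_) (sym (Enabled⇒orig en₀ σ₀b)))) , post

  Occurs : (a : Aut N) → List (Step N) → Fin (m a) → Set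
  Occurs a σs t = ∃[ σ ] (σ ∈ σs × σ a ≡ just t)

  Occurs⇒valid : ∀ {s valid σs a t b l} → OverApprox N s valid → IsTrace N s σs →
                 Occurs a σs t → enab t b ≡ just l → valid b (s b) l
  Occurs⇒valid approx tr (σ , σ∈σs , σa≡t) enab≡l with α , β , refl ← ∈-∃++ σ∈σs
    with trα , en ∷ _ ← IsTrace-++⁻ α tr = approx _ _ _ (enabling-realised α trα en σa≡t enab≡l)

  Occurs-∷ : ∀ {a σ σs t} → Occurs a σs t → Occurs a (σ ∷ σs) t
  Occurs-∷ (σ′ , σ′∈σs , σ′a≡t) = σ′ , there σ′∈σs , σ′a≡t

  local-walk : ∀ a {s} σs → IsTrace N s σs →
               ∃[ ts ] (Local.Walk a (s a) (run s σs a) ts × (∀ {t} → t ∈ ts → Occurs a σs t))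
  local-walk a []       []         = [] , Local.nil , λ ()
  local-walk a {s} (σ ∷ σs) (en ∷ tr) with local-walk a σs tr | σ a in σa
  ... | ts , w , occ | nothing =
    ts , subst (λ x → Local.Walk a x (run (apply N s σ) σs a) ts) (apply-nothing s σ σa) w ,
    Occurs-∷ ∘ occ
  ... | ts , w , occ | just u =
    u ∷ ts ,
    Local.cons (sym (Enabled⇒orig en σa))
               (subst (λ x → Local.Walk a x (run (apply N s σ) σs a) ts) (apply-just s σ σa) w) ,
    λ where (here refl)  → σ , here refl , σa
            (there t∈ts) → Occurs-∷ (occ t∈ts)

  SimplePath⇒IsPath : ∀ {a i j η} → Local.SimplePath a i j η → i ≢ j → IsPath N a i j η
  SimplePath⇒IsPath Local.nil i≢i = ⊥-elim (i≢i refl)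
  SimplePath⇒IsPath {a} p@(Local.cons {e = t} {es = η′} orig≡i _ _ _) _ =
    (t , η′ , refl , orig≡i) , Local.Walk-ends a w , Local.Walk-chained a w , Local.SimplePath-fresh a p
    where
    w = Local.SimplePath⇒Walk a p

  reaching-subtrace-of-minimal : ∀ {s g g⊤ π ϖ} → Minimal N s g g⊤ π → IsTrace N s ϖ →
                                 Sublist (_⊆ₛ_ N) ϖ π → PostTrace N ϖ (g , g⊤) → ¬ ¬ TraceEq N ϖ π
  reaching-subtrace-of-minimal {ϖ = ϖ} (_ , no-smaller) tr sub reach ϖ≉π =
    no-smaller (ϖ , ϖ≉π , tr , length-mono-≤ sub , reach , Sublist⇒Embedding sub)

  proper-prefix-of-minimal-unreaching : ∀ {s g g⊤ π} xs ys → IsTrace N s π → Minimal N s g g⊤ π →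
                                        π ≡ xs ++ ys → ys ≢ [] → ¬ PostTrace N xs (g , g⊤)
  proper-prefix-of-minimal-unreaching xs ys tr mn refl ys≢[] reach =
    reaching-subtrace-of-minimal mn (proj₁ (IsTrace-++⁻ xs tr)) (++ʳ ys (Sublist.refl ⊆ₛ-refl)) reach
      (ys≢[] ∘ Pointwise-++-identityʳ-unique xs)

  module LastStep {s : State N} {g : Aut N} {g⊤ : Fin (k g)} (s≢g⊤ : s g ≢ g⊤)
                  (ρ : List (Step N)) (τ : Step N)
                  (tr : IsTrace N s (ρ ++ [ τ ])) (mn : Minimal N s g g⊤ (ρ ++ [ τ ])) where

    trace-ρ : IsTrace N s ρ
    trace-ρ = proj₁ (IsTrace-++⁻ ρ tr)

    τ-enabled : Enabled N (run s ρ) τ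
    τ-enabled with _ , en ∷ [] ← IsTrace-++⁻ ρ tr = en

    earlier-moves-miss-target : ∀ {t} → Occurs g ρ t → dest t ≢ g⊤
    earlier-moves-miss-target (σ , σ∈ρ , σg≡t) dest≡g⊤ with α , β , ρ≡ ← ∈-∃++ σ∈ρ =
      proper-prefix-of-minimal-unreaching (α ++ [ σ ]) (β ++ [ τ ]) tr mn split
        (λ β++τ≡[] → case ++-conicalʳ β [ τ ] β++τ≡[] of λ ())
        (PostTrace-++[-]⁺ α σ (subst (λ v → PostStep N σ (g , v)) dest≡g⊤ (PostStep-dest σg≡t)))
      where
      open ≡-Reasoning
      split : ρ ++ [ τ ] ≡ (α ++ [ σ ]) ++ β ++ [ τ ]
      split = begin
        ρ ++ [ τ ]                ≡⟨ cong (_++ [ τ ]) ρ≡ ⟩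
        (α ++ σ ∷ β) ++ [ τ ]     ≡⟨ ++-assoc α (σ ∷ β) [ τ ] ⟩
        α ++ σ ∷ β ++ [ τ ]       ≡⟨ ++-assoc α [ σ ] (β ++ [ τ ]) ⟨
        (α ++ [ σ ]) ++ β ++ [ τ ] ∎

    g-misses-target-before-τ : run s ρ g ≢ g⊤
    g-misses-target-before-τ at-g⊤
      with ts , w , occ ← local-walk g ρ trace-ρ
      with t , t∈ts , dest≡ ← Local.Walk-enters g w (λ s≡ → s≢g⊤ (trans s≡ at-g⊤)) =
      earlier-moves-miss-target (occ t∈ts) (trans dest≡ at-g⊤)

    τ-moves-g-to-target : ∃[ t ] (τ g ≡ just t × dest t ≡ g⊤)
    τ-moves-g-to-target with PostTrace-++[-]⁻ ρ τ (proj₁ mn)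
    ... | inj₁ ρ-reaches =
      ⊥-elim (proper-prefix-of-minimal-unreaching ρ [ τ ] tr mn refl (λ ()) ρ-reaches)
    ... | inj₂ ((_ , t , τg≡t , inj₁ eq) , _) with refl , dest≡g⊤ ← Σ-≡,≡←≡ eq = t , τg≡t , dest≡g⊤
    ... | inj₂ ((_ , t , τa≡t , inj₂ enab≡g⊤) , _) =
      ⊥-elim (g-misses-target-before-τ (Enabled⇒enab τ-enabled τa≡t enab≡g⊤))

    -- Dropping a's transition from τ would give a smaller trace that still reaches g⊤.
    τ-moves-only-g : ∀ {a t} → τ a ≡ just t → a ≡ g
    τ-moves-only-g {a} τa≡t with a ≟ g
    ... | yes a≡g = a≡g
    ... | no  a≢g with tg , τg≡tg , tg↦g⊤ ← τ-moves-g-to-target =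
      ⊥-elim (reaching-subtrace-of-minimal mn
        (IsTrace-++⁺ trace-ρ (Enabled-⊆ₛ τ-enabled (without-⊆ₛ τ a) ∷ []))
        (++⁺ (Sublist.refl ⊆ₛ-refl) (without-⊆ₛ τ a ∷ []))
        (PostTrace-++[-]⁺ ρ (τ without a)
          (subst (λ v → PostStep N (τ without a) (g , v)) tg↦g⊤
            (PostStep-dest (trans (without-other τ a≢g) τg≡tg))))
        differs)
      where
      differs : ¬ TraceEq N (ρ ++ [ τ without a ]) (ρ ++ [ τ ])
      differs eq with same ∷ [] ← ++-cancelˡ ρ eq =
        nothing≢just (trans (sym (without-self τ a)) (trans (same a) τa≡t))

    g-ends-at-target : run s (ρ ++ [ τ ]) g ≡ g⊤
    g-ends-at-target with tg , τg≡tg , tg↦g⊤ ← τ-moves-g-to-target =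
      trans (cong-app (foldl-∷ʳ (apply N) s τ ρ) g) (trans (apply-just (run s ρ) τ τg≡tg) tg↦g⊤)

    entering-target-is-τ : ∀ {t} → Occurs g (ρ ++ [ τ ]) t → dest t ≡ g⊤ → τ g ≡ just t
    entering-target-is-τ (σ , σ∈π , σg≡t) dest≡g⊤ with ∈-++⁻ ρ σ∈π
    ... | inj₁ σ∈ρ         = ⊥-elim (earlier-moves-miss-target (σ , σ∈ρ , σg≡t) dest≡g⊤)
    ... | inj₂ (here refl) = σg≡t

    -- The loop-free path still has to enter g⊤, and the only edge of the walk doing so is τ's.
    local-path-to-target : ∀ {valid t} → OverApprox N s valid → τ g ≡ just t →
                           ∃[ η ] (RCSol N s valid g (s g) g⊤ η × t ∈ η)
    local-path-to-target approx τg≡t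
      with ts , w , occ ← local-walk g (ρ ++ [ τ ]) tr
      with η , p , η⊆ts ← Local.erase-loops g (subst (λ x → Local.Walk g (s g) x ts) g-ends-at-target w)
      with e , e∈η , e↦g⊤ ← Local.Walk-enters g (Local.SimplePath⇒Walk g p) s≢g⊤
      with refl ← just-injective (trans (sym τg≡t) (entering-target-is-τ (occ (η⊆ts e∈η)) e↦g⊤)) =
      η , (inj₂ (s≢g⊤ , SimplePath⇒IsPath p s≢g⊤) ,
           λ i b l enab≡l → Occurs⇒valid approx tr (occ (η⊆ts (∈-lookup i))) enab≡l) , e∈η

lemma2 : (N : Network) (s : State N) (g : Fin (Network.n N)) (g⊤ : Fin (Network.k N g)) →
         s g ≢ g⊤ →
         (valid : ObjPred N) → OverApprox N s valid →
         (π : List (Step N)) → IsTrace N s π → Minimal N s g g⊤ π →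
         ∀ ρ τ → π ≡ ρ ++ [ τ ] → StepInTrB N s g g⊤ valid τ
lemma2 N s g g⊤ s≢g⊤ valid approx π tr mn ρ τ refl a t τa≡t
  with refl ← LastStep.τ-moves-only-g N s≢g⊤ ρ τ tr mn τa≡t
  with η , sol , t∈η ← LastStep.local-path-to-target N s≢g⊤ ρ τ tr mn approx τa≡t =
  s g , g⊤ , η , rule1 , sol , t∈η
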